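{- Let $S = S_1 \bowtie_{{\tt H},{\tt K}} S_2$ be the composition of communicating systems $S_1$ and $S_2$ (with disjoint role sets $\mathbf{P}_1,\mathbf{P}_2$) with respect to roles ${\tt H}\in\mathbf{P}_1$, ${\tt K}\in\mathbf{P}_2$ with $M^1_{\tt H}\leftrightarrow M^2_{\tt K}$. Let $s=(\vec q,\vec\varepsilon)\in RS(S)$ be a deadlock configuration of $S$. Then either $s|_1\in RS(S_1)$ and $s|_1$ is a deadlock configuration of $S_1$, or $s|_2\in RS(S_2)$ and $s|_2$ is a deadlock configuration of $S_2$ (or both).
   Context: A CFSM over finite sets $\mathbf{P}$ of roles and $\mathbb{A}$ of messages is $M=(Q,q_0,\mathbb{A},\delta)$ with $Q$ finite, $q_0\in Q$, $\delta\subseteq Q\times Act\times Q$, where $Act=C_\mathbf{P}\times\{!,?\}\times\mathbb{A}$ and $C_\mathbf{P}=\{\mathtt{p}\mathtt{q}\mid \mathtt{p},\mathtt{q}\in\mathbf{P},\mathtt{p}\neq\mathtt{q}\}$. Label $\mathtt{s}\mathtt{r}!a$: $\mathtt{s}$ sends $a$ on channel $\mathtt{s}\mathtt{r}$; $\mathtt{s}\mathtt{r}?a$: $\mathtt{r}$ consumes $a$ from channel $\mathtt{s}\mathtt{r}$. $\mathcal{L}(M)\subseteq Act^*$ is the language of $M$ with all states accepting. A state is final if it has no outgoing transition, sending (resp. receiving) if all its outgoing transitions are labelled by sending (resp. receiving) actions, mixed otherwise. $M$ is ?-deterministic if for every state $q$, $(q,\mathtt{r}\mathtt{s}?a,q'),(q,\mathtt{p}\mathtt{q}?a,q'')\in\delta$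 imply $q'=q''$; !-deterministic analogously; ?!-deterministic if both. A communicating system over $\mathbf{P},\mathbb{A}$ is $S=(M_\mathtt{p})_{\mathtt{p}\in\mathbf{P}}$, $M_\mathtt{p}=(Q_\mathtt{p},q_{0\mathtt{p}},\mathbb{A},\delta_\mathtt{p})$. Configuration $s=(\vec q,\vec w)$: $q_\mathtt{p}\in Q_\mathtt{p}$, $w_{\mathtt{p}\mathtt{q}}\in\mathbb{A}^*$ per channel; initial: initial states, empty channels. $s\to s'$ via $\mathtt{s}\mathtt{r}!a$ if $(q_\mathtt{s},\mathtt{s}\mathtt{r}!a,q'_\mathtt{s})\in\delta_\mathtt{s}$, others unchanged, $w'_{\mathtt{s}\mathtt{r}}=w_{\mathtt{s}\mathtt{r}}a$; via $\mathtt{s}\mathtt{r}?a$ if $(q_\mathtt{r},\mathtt{s}\mathtt{r}?a,q'_\mathtt{r})\in\delta_\mathtt{r}$, others unchanged, $w_{\mathtt{s}\mathtt{r}}=a w'_{\mathtt{s}\mathtt{r}}$. $RS(S)$: reachable configurations. A configuration $(\vec q,\vec w)$ is a deadlock configuration if $\vec w=\vec\varepsilon$ (all channels empty) and every $q_\mathtt{p}$ is a receiving state. $\varphi^{\not C}$ erases channel names from a word over $Act$; $\overline{\cdot}$ swaps $!a$ and $?a$. $M\leftrightarrow M'$ (compatible) if $\mathcal{L}(M)^{\not C}=\overline{\mathcal{L}(M')^{\not C}}$, neither has mixed states, both ?!-deterministic. Gateway $\mathrm{gw}(M_{\tt H},{\tt K})$ for $M_{\tt H}=(Q,q_0,\mathbb{A},\delta)$: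 states $Q\cup\widehat Q$, with one fresh state $q^t$ per $t=(q,l,q')\in\delta$; transitions: for $t=(q,{\tt H}\mathtt{s}!a,q')\in\delta$, $(q,{\tt K}{\tt H}?a,q^t),(q^t,{\tt H}\mathtt{s}!a,q')$; for $t=(q,\mathtt{s}{\tt H}?a,q')\in\delta$, $(q,\mathtt{s}{\tt H}?a,q^t),(q^t,{\tt H}{\tt K}!a,q')$; initial state $q_0$. Composition: $S_1=(M^1_\mathtt{p})_{\mathtt{p}\in\mathbf{P}_1}$ over $\mathbf{P}_1,\mathbb{A}_1$, $S_2=(M^2_\mathtt{p})_{\mathtt{p}\in\mathbf{P}_2}$ over $\mathbf{P}_2,\mathbb{A}_2$, $\mathbf{P}_1\cap\mathbf{P}_2=\emptyset$, $M^1_{\tt H}\leftrightarrow M^2_{\tt K}$; $S_1\bowtie_{{\tt H},{\tt K}}S_2=(M_\mathtt{p})_{\mathtt{p}\in\mathbf{P}_1\cup\mathbf{P}_2}$ over $\mathbf{P}_1\cup\mathbf{P}_2$, $\mathbb{A}_1\cup\mathbb{A}_2$, with $M_{\tt H}=\mathrm{gw}(M^1_{\tt H},{\tt K})$, $M_{\tt K}=\mathrm{gw}(M^2_{\tt K},{\tt H})$, $M_\mathtt{p}=M^i_\mathtt{p}$ otherwise. For a configuration $s=(\vec q,\vec w)$ of $S$, $s|_i=((q_\mathtt{p})_{\mathtt{p}\in\mathbf{P}_i},(w_{\mathtt{p}\mathtt{q}})_{\mathtt{p}\mathtt{q}\in C_{\mathbf{P}_i}})$. -}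

module Defs where

open import Data.Fin using (Fin) renaming (_≟_ to _≟F_)
open import Data.List using (List; []; _∷_; _++_; [_]; map; lookup; length; concatMap; allFin)
open import Data.List.Membership.Propositional using (_∈_; _∉_)
open import Data.List.Membership.Propositional.Properties using (∈-map⁺; ∈-++⁺ˡ; ∈-++⁺ʳ; ∈-allFin)
open import Data.Sum using (_⊎_; inj₁; inj₂)
import Data.Sum.Properties as SumP
open import Data.Product using (Σ; ∃; _×_; _,_)
open import Relation.Binary.PropositionalEquality using (_≡_; _≢_; refl; sym)
open import Relation.Binary.Definitions using (DecidableEquality)
open import Relation.Nullary using (¬_; yes; no)

data Dir : Set where
  snd rcv : Dir          -- snd = '!', rcv = '?'

record Act (P A : Set) : Set where
  constructor act
  field
    src       : P
    dst       : P
    .distinct : src ≢ dst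
    dir       : Dir
    msg       : A
open Act public

-- CFSMs: finite state set (decidable equality + complete enumeration),
-- finite transition relation given as a list.

record CFSM (P A : Set) : Set₁ where
  field
    Q         : Set
    _≟Q_      : DecidableEquality Q
    states    : List Q
    allStates : ∀ q → q ∈ states
    q₀        : Q
    δ         : List (Q × Act P A × Q)
open CFSM public

module _ {P A : Set} (M : CFSM P A) where

  -- runs and the language (all states accepting)
  data Run : Q M → List (Act P A) → Q M → Set where
    done : ∀ {q} → Run q [] q
    next : ∀ {q l q' u q''} → (q , l , q') ∈ δ M → Run q' u q'' → Run q (l ∷ u) q''

  Lang : List (Act P A) → Set
  Lang u = ∃ λ q → Run (q₀ M) u q

  Final : Q M → Set
  Final q = ∀ l q' → (q , l , q') ∉ δ M

  Sending : Q M → Set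
  Sending q = ∀ {l q'} → (q , l , q') ∈ δ M → dir l ≡ snd

  Receiving : Q M → Set
  Receiving q = ∀ {l q'} → (q , l , q') ∈ δ M → dir l ≡ rcv

  Mixed : Q M → Set
  Mixed q = ¬ Final q × ¬ Sending q × ¬ Receiving q

  NoMixed : Set
  NoMixed = ∀ q → ¬ Mixed q

  -- d-determinism (d = rcv : ?-deterministic, d = snd : !-deterministic)
  Det : Dir → Set
  Det d = ∀ {q l l' q₁ q₂} → dir l ≡ d → dir l' ≡ d → msg l ≡ msg l' →
          (q , l , q₁) ∈ δ M → (q , l' , q₂) ∈ δ M → q₁ ≡ q₂

  ?!Det : Set
  ?!Det = Det rcv × Det snd

erase : ∀ {P A : Set} → Act P A → Dir × A
erase (act _ _ _ d a) = d , a

flipDir : Dir → Dir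
flipDir snd = rcv
flipDir rcv = snd

dual : ∀ {A : Set} → Dir × A → Dir × A
dual (d , a) = flipDir d , a

ELang : ∀ {P A : Set} → CFSM P A → List (Dir × A) → Set
ELang M w = ∃ λ u → Lang M u × map erase u ≡ w

Compatible : ∀ {P P' A : Set} → CFSM P A → CFSM P' A → Set
Compatible M M' =
  (∀ w → (ELang M w → ELang M' (map dual w)) × (ELang M' (map dual w) → ELang M w))
  × NoMixed M × NoMixed M' × ?!Det M × ?!Det M'

System : Set → Set → Set₁
System P A = P → CFSM P A

record Config {P A : Set} (S : System P A) : Set where
  constructor ⟨_,_⟩
  field
    st : (p : P) → Q (S p)
    ch : P → P → List A     -- ch p q = contents of channel pq
open Config public

module _ {P A : Set} (S : System P A) where

  Initial : Config S → Set
  Initial c = (∀ p → st c p ≡ q₀ (S p)) × (∀ p q → ch c p q ≡ [])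

  data Step (c c' : Config S) : Set where
    send : (l : Act P A) → dir l ≡ snd →
           (st c (src l) , l , st c' (src l)) ∈ δ (S (src l)) →
           (∀ p → p ≢ src l → st c' p ≡ st c p) →
           ch c' (src l) (dst l) ≡ ch c (src l) (dst l) ++ [ msg l ] →
           (∀ x y → ¬ (x ≡ src l × y ≡ dst l) → ch c' x y ≡ ch c x y) →
           Step c c'
    recv : (l : Act P A) → dir l ≡ rcv →
           (st c (dst l) , l , st c' (dst l)) ∈ δ (S (dst l)) →
           (∀ p → p ≢ dst l → st c' p ≡ st c p) →
           ch c (src l) (dst l) ≡ msg l ∷ ch c' (src l) (dst l) →
           (∀ x y → ¬ (x ≡ src l × y ≡ dst l) → ch c' x y ≡ ch c x y) →
           Step c c'

  data Reach : Config S → Set where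
    init : ∀ {c} → Initial c → Reach c
    step : ∀ {c c'} → Reach c → Step c c' → Reach c'

  Deadlock : Config S → Set
  Deadlock c = (∀ p q → ch c p q ≡ []) × (∀ p → Receiving (S p) (st c p))

liftAct : ∀ {P P' A : Set} (e : P → P') → (∀ {x y} → e x ≡ e y → x ≡ y) →
          Act P A → Act P' A
liftAct e inj (act s r ne d a) = act (e s) (e r) (λ eq → ne (inj eq)) d a

liftM : ∀ {P P' A : Set} (e : P → P') → (∀ {x y} → e x ≡ e y → x ≡ y) →
        CFSM P A → CFSM P' A
liftM e inj M = record
  { Q = Q M ; _≟Q_ = _≟Q_ M ; states = states M ; allStates = allStates M
  ; q₀ = q₀ M
  ; δ = map (λ { (q , l , q') → q , liftAct e inj l , q' }) (δ M) }

-- Gateway gw(M_H, K): states Q ∪ Q̂ where Q̂ has one fresh state per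
-- transition of δ (indexed by its position in the list δ).

module Gateway {P P' A : Set} (_≟P_ : DecidableEquality P)
               (e : P → P') (inj : ∀ {x y} → e x ≡ e y → x ≡ y)
               (M : CFSM P A) (H : P) (K : P') (fresh : ∀ p → e p ≢ K) where

  GQ : Set
  GQ = Q M ⊎ Fin (length (δ M))

  gwT : Fin (length (δ M)) → List (GQ × Act P' A × GQ)
  gwT i = aux (lookup (δ M) i)
    where
    aux : Q M × Act P A × Q M → List (GQ × Act P' A × GQ)
    aux (q , l@(act s r ne snd a) , q') with s ≟P H
    ... | yes _ = (inj₁ q , act K (e H) (λ eq → fresh H (sym eq)) rcv a , inj₂ i)
                ∷ (inj₂ i , liftAct e inj l , inj₁ q') ∷ []
    ... | no _  = []
    aux (q , l@(act s r ne rcv a) , q') with r ≟P H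
    ... | yes _ = (inj₁ q , liftAct e inj l , inj₂ i)
                ∷ (inj₂ i , act (e H) K (fresh H) snd a , inj₁ q') ∷ []
    ... | no _  = []

  gw : CFSM P' A
  gw = record
    { Q = GQ
    ; _≟Q_ = SumP.≡-dec (_≟Q_ M) _≟F_
    ; states = map inj₁ (states M) ++ map inj₂ (allFin _)
    ; allStates = λ { (inj₁ q) → ∈-++⁺ˡ (∈-map⁺ inj₁ (allStates M q))
                    ; (inj₂ i) → ∈-++⁺ʳ (map inj₁ (states M)) (∈-map⁺ inj₂ (∈-allFin i)) }
    ; q₀ = inj₁ (q₀ M)
    ; δ = concatMap gwT (allFin _) }

inj₁-inj : ∀ {X Y : Set} {x y : X} → inj₁ {B = Y} x ≡ inj₁ y → x ≡ y
inj₁-inj refl = refl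

inj₂-inj : ∀ {X Y : Set} {x y : Y} → inj₂ {A = X} x ≡ inj₂ y → x ≡ y
inj₂-inj refl = refl

module _ {n₁ n₂ : _} {A : Set} (S₁ : System (Fin n₁) A) (S₂ : System (Fin n₂) A)
         (H : Fin n₁) (K : Fin n₂) where

  private
    R = Fin n₁ ⊎ Fin n₂

  compose : System R A
  compose (inj₁ p) with p ≟F H
  ... | yes _ = Gateway.gw _≟F_ inj₁ inj₁-inj (S₁ p) H (inj₂ K) (λ _ ())
  ... | no _  = liftM inj₁ inj₁-inj (S₁ p)
  compose (inj₂ p) with p ≟F K
  ... | yes _ = Gateway.gw _≟F_ inj₂ inj₂-inj (S₂ p) K (inj₁ H) (λ _ ())
  ... | no _  = liftM inj₂ inj₂-inj (S₂ p)

  -- states of S_i seen as states of the composed machines (q ↦ q ∈ Q ⊆ Q ∪ Q̂)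
  embSt₁ : (p : Fin n₁) → Q (S₁ p) → Q (compose (inj₁ p))
  embSt₁ p q with p ≟F H
  ... | yes _ = inj₁ q
  ... | no _  = q

  embSt₂ : (p : Fin n₂) → Q (S₂ p) → Q (compose (inj₂ p))
  embSt₂ p q with p ≟F K
  ... | yes _ = inj₁ q
  ... | no _  = q

  Restr₁ : Config compose → Config S₁ → Set
  Restr₁ s c₁ = (∀ p → st s (inj₁ p) ≡ embSt₁ p (st c₁ p))
              × (∀ p q → ch s (inj₁ p) (inj₁ q) ≡ ch c₁ p q)

  Restr₂ : Config compose → Config S₂ → Set
  Restr₂ s c₂ = (∀ p → st s (inj₂ p) ≡ embSt₂ p (st c₂ p))
              × (∀ p q → ch s (inj₂ p) (inj₂ q) ≡ ch c₂ p q)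

_⋈[_,_]_ : ∀ {n₁ n₂ A} → System (Fin n₁) A → Fin n₁ → Fin n₂ → System (Fin n₂) A →
            System (Fin n₁ ⊎ Fin n₂) A
S₁ ⋈[ H , K ] S₂ = compose S₁ S₂ H K

-- Two independent facts about a reachable configuration s of S are combined.
-- (1) Projection: each side Sᵢ simulates its part of S up to stuttering (a
--     gateway step that only talks to the other gateway is invisible on its
--     own side), so the restriction s|ᵢ, reading a gateway through the state
--     of Mᵢ its own side observes, is reachable in Sᵢ.
-- (2) Relay invariant: the two gateways have agreed on a trace w such that
--     M₁ has run w and M₂ the dual of w, each followed by the receives whose
--     messages are still in transit to the other gateway, and at most one
--     side has such messages.  Compatibility keeps it true: M₂ answers every
--     step of M₁, and being deterministic without mixed states it cannot have
--     received when M₁ receives.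
-- At a deadlock the bridge channels are empty, so both gateways are idle at
-- states reached by dual traces, one of which must be receiving; that side's
-- restriction is then a deadlock of its component.
module Submission where

open import Defs
open import Data.Nat using (ℕ)
open import Data.Fin using (Fin) renaming (_≟_ to _≟F_)
open import Data.List using (List; []; _∷_; _++_; [_]; map; lookup; length; allFin)
open import Data.List.Properties using (map-++; ++-assoc; ++-identityʳ; ∷-injective; ∷-injectiveˡ)
open import Data.List.Membership.Propositional using (_∈_; lose; find)
open import Data.List.Membership.Propositional.Properties using (∈-map⁻; ∈-map⁺; ∈-concatMap⁻; ∈-concatMap⁺; ∈-lookup; ∈-allFin)
open import Data.List.Relation.Unary.Any using (here; there; satisfied; any?)
open import Data.Sum using (_⊎_; inj₁; inj₂) renaming (swap to swap-⊎)
open import Data.Product using (∃; _×_; _,_; proj₁; proj₂)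
open import Data.Empty using (⊥; ⊥-elim)
open import Relation.Binary.PropositionalEquality using (_≡_; _≢_; refl; sym; trans; cong; subst; subst₂)
open import Relation.Binary.Definitions using (DecidableEquality)
open import Relation.Nullary using (¬_; Dec; yes; no)
open import Relation.Nullary.Decidable using (_×-dec_)
open import Function using (_∘_)

snd≢rcv : snd ≢ rcv
snd≢rcv ()

not-snd : ∀ {d} → d ≢ snd → d ≡ rcv
not-snd {snd} d≢snd = ⊥-elim (d≢snd refl)
not-snd {rcv} _ = refl

is-snd? : (d : Dir) → Dec (d ≡ snd)
is-snd? snd = yes refl
is-snd? rcv = no (λ ())

dual-dual : ∀ {A : Set} (w : List (Dir × A)) → map dual (map dual w) ≡ w
dual-dual [] = refl
dual-dual ((snd , a) ∷ w) = cong ((snd , a) ∷_) (dual-dual w)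
dual-dual ((rcv , a) ∷ w) = cong ((rcv , a) ∷_) (dual-dual w)

module Runs {P A : Set} (M : CFSM P A) where

  ERun : Q M → List (Dir × A) → Q M → Set
  ERun q w q' = ∃ λ u → Run M q u q' × map erase u ≡ w

  cast : ∀ {q w w' q'} → w ≡ w' → ERun q w q' → ERun q w' q'
  cast {q} {q' = q'} = subst (λ w → ERun q w q')

  empty : ∀ {q} → ERun q [] q
  empty = [] , done , refl

  accepted : ∀ {w q} → ERun (q₀ M) w q → ELang M w
  accepted (u , r , eq) = u , (_ , r) , eq

  run-snoc : ∀ {q u q' l q''} → Run M q u q' → (q' , l , q'') ∈ δ M → Run M q (u ++ [ l ]) q''
  run-snoc done t = next t done
  run-snoc (next t' r) t = next t' (run-snoc r t)

  snoc : ∀ {q w q' l q''} → ERun q w q' → (q' , l , q'') ∈ δ M → ERun q (w ++ [ erase l ]) q''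
  snoc {l = l} (u , r , refl) t = u ++ [ l ] , run-snoc r t , map-++ erase u [ l ]

  split : ∀ {q} w₁ w₂ {q''} → ERun q (w₁ ++ w₂) q'' → ∃ λ q' → ERun q w₁ q' × ERun q' w₂ q''
  split [] w₂ r = _ , empty , r
  split (x ∷ w₁) w₂ ([] , done , ())
  split (x ∷ w₁) w₂ (l ∷ u , next t r , eq) with ∷-injective eq
  ... | refl , eq' with split w₁ w₂ (u , r , eq')
  ...   | q' , (u₁ , r₁ , refl) , rest = q' , (l ∷ u₁ , next t r₁ , refl) , rest

  first : ∀ {q x w q'} → ERun q (x ∷ w) q' → ∃ λ l → ∃ λ q₁ → (q , l , q₁) ∈ δ M × erase l ≡ x
  first ([] , done , ())
  first (l ∷ _ , next t _ , eq) = l , _ , t , ∷-injectiveˡ eq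

  unmixed : NoMixed M → ∀ {q l₁ q₁ l₂ q₂} → (q , l₁ , q₁) ∈ δ M → dir l₁ ≡ snd →
            (q , l₂ , q₂) ∈ δ M → dir l₂ ≡ rcv → ⊥
  unmixed noMixed {q} t₁ d₁ t₂ d₂ =
    noMixed q ( (λ final → final _ _ t₁)
              , (λ sending → snd≢rcv (trans (sym (sending t₂)) d₂))
              , (λ receiving → snd≢rcv (trans (sym d₁) (receiving t₁))) )

  receiving-or-sends : ∀ q → Receiving M q ⊎ ∃ λ l → ∃ λ q' → (q , l , q') ∈ δ M × dir l ≡ snd
  receiving-or-sends q with any? sends-from? (δ M)
    where
    sends-from? : (t : Q M × Act P A × Q M) → Dec (proj₁ t ≡ q × dir (proj₁ (proj₂ t)) ≡ snd)
    sends-from? (q₁ , l , _) = _≟Q_ M q₁ q ×-dec is-snd? (dir l)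
  ... | yes found with find found
  ...   | (_ , l , q') , t , refl , d = inj₂ (l , q' , t , d)
  receiving-or-sends q | no none = inj₁ λ t → not-snd (λ d → none (lose t (refl , d)))

  module Deterministic (det : ?!Det M) where

    step-det : ∀ {q l l' q₁ q₂} → erase l ≡ erase l' → (q , l , q₁) ∈ δ M → (q , l' , q₂) ∈ δ M → q₁ ≡ q₂
    step-det {l = act _ _ _ snd _} {act _ _ _ snd _} refl = proj₂ det refl refl refl
    step-det {l = act _ _ _ rcv _} {act _ _ _ rcv _} refl = proj₁ det refl refl refl

    runs-det : ∀ {q u u' q₁ q₂} → Run M q u q₁ → Run M q u' q₂ → map erase u ≡ map erase u' → q₁ ≡ q₂
    runs-det done done _ = refl
    runs-det done (next _ _) ()
    runs-det (next _ _) done ()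
    runs-det (next t r) (next t' r') eq with ∷-injective eq
    ... | e , eq' with step-det e t t'
    ...   | refl = runs-det r r' eq'

    continue : ∀ {w q x} → ERun (q₀ M) w q → ELang M (w ++ [ x ]) →
               ∃ λ l → ∃ λ q' → (q , l , q') ∈ δ M × erase l ≡ x
    continue {w} {x = x} (u , r , eq) (u' , (_ , r') , eq') with split w [ x ] (u' , r' , eq')
    ... | _ , (u₁ , r₁ , eq₁) , rest with runs-det r r₁ (trans eq (sym eq₁))
    ...   | refl = first rest

Mirrors : ∀ {P P' A : Set} → CFSM P A → CFSM P' A → Set
Mirrors M M' = ∀ {w} → ELang M w → ELang M' (map dual w)

compatible-mirrors : ∀ {P P' A : Set} {M : CFSM P A} {M' : CFSM P' A} →
                     Compatible M M' → Mirrors M M' × Mirrors M' M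
compatible-mirrors {M' = M'} c =
  (λ {w} → proj₁ (proj₁ c w))
  , (λ {w} el → proj₂ (proj₁ c (map dual w)) (subst (ELang M') (sym (dual-dual w)) el))

module Answer {P P' A : Set} {M : CFSM P A} {M' : CFSM P' A}
              (mirror : Mirrors M M') (det' : ?!Det M') (noMixed' : NoMixed M') where
  private
    module R = Runs M
    module R' = Runs M'
  open R'.Deterministic det'

  answer : ∀ {w q l q₁ q'} → R.ERun (q₀ M) w q → (q , l , q₁) ∈ δ M → R'.ERun (q₀ M') (map dual w) q' →
           ∃ λ l' → ∃ λ q₁' → (q' , l' , q₁') ∈ δ M' × erase l' ≡ dual (erase l)
  answer {w} {l = l} r t r' =
    continue r' (subst (ELang M') (map-++ dual w [ erase l ]) (mirror (R.accepted (R.snoc r t))))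

  no-crossing : ∀ {w q l q₁ b rest q'} → R.ERun (q₀ M) w q → (q , l , q₁) ∈ δ M → dir l ≡ rcv →
                R'.ERun (q₀ M') (map dual w ++ (rcv , b) ∷ rest) q' → ⊥
  no-crossing {w} r t d r' with R'.split (map dual w) _ r'
  ... | _ , r₁ , r₂ with answer r t r₁ | R'.first r₂
  ...   | _ , _ , t' , e' | _ , _ , t'' , e'' =
    R'.unmixed noMixed' t' (trans (cong proj₁ e') (cong flipDir d)) t'' (cong proj₁ e'')

  one-receives : ∀ {w q q'} → R.ERun (q₀ M) w q → R'.ERun (q₀ M') (map dual w) q' →
                 Receiving M q ⊎ Receiving M' q'
  one-receives {q = q} {q'} r r' with R.receiving-or-sends q | R'.receiving-or-sends q'
  ... | inj₁ receiving | _ = inj₁ receiving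
  ... | inj₂ _ | inj₁ receiving' = inj₂ receiving'
  ... | inj₂ (_ , _ , t , d) | inj₂ (_ , _ , t'' , d'') with answer r t r'
  ...   | _ , _ , t' , e' = ⊥-elim (R'.unmixed noMixed' t'' d'' t' (trans (cong proj₁ e') (cong flipDir d)))

record ChannelEffect {R A : Set} (x y : R) (l : Act R A) (c c' : List A) : Set where
  field
    untouched : ¬ (x ≡ src l × y ≡ dst l) → c' ≡ c
    appended  : x ≡ src l → y ≡ dst l → dir l ≡ snd → c' ≡ c ++ [ msg l ]
    popped    : x ≡ src l → y ≡ dst l → dir l ≡ rcv → c ≡ msg l ∷ c'
open ChannelEffect

Performs : ∀ {R A : Set} → R → Act R A → Set
Performs r l = (dir l ≡ snd × r ≡ src l) ⊎ (dir l ≡ rcv × r ≡ dst l)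

untouched-by : ∀ {R A : Set} {r x y : R} {l : Act R A} {c c'} →
               Performs r l → r ≢ x → r ≢ y → ChannelEffect x y l c c' → c' ≡ c
untouched-by (inj₁ (_ , refl)) r≢x _ eff = untouched eff (λ { (x≡ , _) → r≢x (sym x≡) })
untouched-by (inj₂ (_ , refl)) _ r≢y eff = untouched eff (λ { (_ , y≡) → r≢y (sym y≡) })

module Moves {R A : Set} (S : System R A) where

  record Move (c c' : Config S) : Set where
    constructor mkMove
    field
      actor      : R
      label      : Act R A
      performs   : Performs actor label
      transition : (st c actor , label , st c' actor) ∈ δ (S actor)
      others     : ∀ p → p ≢ actor → st c' p ≡ st c p
      channels   : ∀ x y → ChannelEffect x y label (ch c x y) (ch c' x y)

  move : ∀ {c c'} → Step S c c' → Move c c'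
  move {c} {c'} (send l d t others grown same) = mkMove (src l) l (inj₁ (d , refl)) t others effect
    where
    effect : ∀ x y → ChannelEffect x y l (ch c x y) (ch c' x y)
    effect x y = record
      { untouched = same x y
      ; appended  = λ x≡ y≡ _ → subst₂ (λ x y → ch c' x y ≡ ch c x y ++ [ msg l ]) (sym x≡) (sym y≡) grown
      ; popped    = λ _ _ d' → ⊥-elim (snd≢rcv (trans (sym d) d')) }
  move {c} {c'} (recv l d t others shrunk same) = mkMove (dst l) l (inj₂ (d , refl)) t others effect
    where
    effect : ∀ x y → ChannelEffect x y l (ch c x y) (ch c' x y)
    effect x y = record
      { untouched = same x y
      ; appended  = λ _ _ d' → ⊥-elim (snd≢rcv (trans (sym d') d))
      ; popped    = λ x≡ y≡ _ → subst₂ (λ x y → ch c x y ≡ msg l ∷ ch c' x y) (sym x≡) (sym y≡) shrunk }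

  as-step : ∀ {c c'} → Move c c' → Step S c c'
  as-step (mkMove _ l (inj₁ (d , refl)) t others eff) =
    send l d t others (appended (eff _ _) refl refl d) (λ x y → untouched (eff x y))
  as-step (mkMove _ l (inj₂ (d , refl)) t others eff) =
    recv l d t others (popped (eff _ _) refl refl d) (λ x y → untouched (eff x y))

  _≈_ : Config S → Config S → Set
  c ≈ d = (∀ p → st c p ≡ st d p) × (∀ p q → ch c p q ≡ ch d p q)

  retarget : ∀ {c c' d} → Move c c' → c' ≈ d → Move c d
  retarget {c} (mkMove r l perf t others eff) (same-st , same-ch) =
    mkMove r l perf (subst (λ z → (st c r , l , z) ∈ δ (S r)) (same-st r) t)
      (λ p p≢r → trans (sym (same-st p)) (others p p≢r))
      (λ x y → subst (ChannelEffect x y l (ch c x y)) (same-ch x y) (eff x y))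

  reach-≈ : ∀ {c d} → Reach S c → c ≈ d → Reach S d
  reach-≈ (init (initial-st , initial-ch)) (same-st , same-ch) =
    init ((λ p → trans (sym (same-st p)) (initial-st p)) , (λ p q → trans (sym (same-ch p q)) (initial-ch p q)))
  reach-≈ (step r s) c'≈d = step r (as-step (retarget (move s) c'≈d))

Outside : ∀ {P R A : Set} → (P → R) → Act R A → Set
Outside e l = (∀ x → e x ≢ src l) ⊎ (∀ y → e y ≢ dst l)

data Simulated {P R A : Set} (e : P → R) (e-inj : ∀ {x y} → e x ≡ e y → x ≡ y)
               (M : CFSM P A) (q : Q M) : Act R A → Q M → Set where
  lifted : ∀ {l q'} → (q , l , q') ∈ δ M → Simulated e e-inj M q (liftAct e e-inj l) q'
  hidden : ∀ {l q'} → q ≡ q' → Outside e l → Simulated e e-inj M q l q'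

module Lifting {P R A : Set} (e : P → R) (e-inj : ∀ {x y} → e x ≡ e y → x ≡ y) where

  lifted-simulates : ∀ {M : CFSM P A} {q l q'} → (q , l , q') ∈ δ (liftM e e-inj M) →
                     Simulated e e-inj M q l q'
  lifted-simulates t with ∈-map⁻ _ t
  ... | _ , t₀ , refl = lifted t₀

  lifted-receiving : ∀ {M : CFSM P A} {q} → Receiving (liftM e e-inj M) q → Receiving M q
  lifted-receiving receiving t = receiving (∈-map⁺ _ t)

  performs-lift : ∀ {p} {l : Act P A} → Performs (e p) (liftAct e e-inj l) → Performs p l
  performs-lift (inj₁ (d , eq)) = inj₁ (d , e-inj eq)
  performs-lift (inj₂ (d , eq)) = inj₂ (d , e-inj eq)

  effect-lift : ∀ {x y} {l : Act P A} {c c'} →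
                ChannelEffect (e x) (e y) (liftAct e e-inj l) c c' → ChannelEffect x y l c c'
  effect-lift eff = record
    { untouched = λ ne → untouched eff (λ { (ex , ey) → ne (e-inj ex , e-inj ey) })
    ; appended  = λ ex ey → appended eff (cong e ex) (cong e ey)
    ; popped    = λ ex ey → popped eff (cong e ex) (cong e ey) }

  outside-untouched : ∀ {x y} {l : Act R A} {c c'} → Outside e l → ChannelEffect (e x) (e y) l c c' → c' ≡ c
  outside-untouched (inj₁ no-src) eff = untouched eff (λ { (ex , _) → no-src _ ex })
  outside-untouched (inj₂ no-dst) eff = untouched eff (λ { (_ , ey) → no-dst _ ey })

  performer-outside : ∀ {r} {l : Act R A} → Performs r l → (∀ p → e p ≢ r) → Outside e l
  performer-outside (inj₁ (_ , refl)) not-image = inj₁ not-image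
  performer-outside (inj₂ (_ , refl)) not-image = inj₂ not-image

-- Projection of a system S onto a system T embedded in it by e, when each
-- machine S (e p) simulates T p through `local` (up to hidden moves): every
-- reachable configuration of S projects to a reachable one of T.
module Projection {P R A : Set} (_≟P_ : DecidableEquality P) (S : System R A) (T : System P A)
    (e : P → R) (e-inj : ∀ {x y} → e x ≡ e y → x ≡ y)
    (image? : ∀ r → (∃ λ p → e p ≡ r) ⊎ (∀ p → e p ≢ r))
    (local : ∀ p → Q (S (e p)) → Q (T p))
    (local-q₀ : ∀ p → local p (q₀ (S (e p))) ≡ q₀ (T p))
    (simulate : ∀ p {g l g'} → (g , l , g') ∈ δ (S (e p)) →
                Simulated e e-inj (T p) (local p g) l (local p g')) where

  open Lifting {A = A} e e-inj
  open Moves S using (Move; mkMove; move)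
  open Moves T using (_≈_; reach-≈) renaming (Move to MoveT; mkMove to mkMoveT; as-step to as-stepT)

  project : Config S → Config T
  project s = ⟨ (λ p → local p (st s (e p))) , (λ p q → ch s (e p) (e q)) ⟩

  project-move : ∀ {s s'} → Move s s' → MoveT (project s) (project s') ⊎ (project s ≈ project s')
  project-move {s} {s'} (mkMove r l perf t others eff) with image? r
  ... | inj₂ not-image =
    inj₂ ( (λ p → cong (local p) (sym (others (e p) (not-image p))))
         , (λ x y → sym (outside-untouched (performer-outside {l = l} perf not-image) (eff (e x) (e y)))) )
  ... | inj₁ (p , refl) with simulate p t
  ...   | lifted {l = l₀} t₀ =
    inj₁ (mkMoveT p l₀ (performs-lift {l = l₀} perf) t₀
            (λ p' p'≢p → cong (local p') (others (e p') (λ eq → p'≢p (e-inj eq))))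
            (λ x y → effect-lift {l = l₀} (eff (e x) (e y))))
  ...   | hidden same out =
    inj₂ ((λ p' → unmoved p' (p' ≟P p)) , (λ x y → sym (outside-untouched out (eff (e x) (e y)))))
    where
    unmoved : ∀ p' → Dec (p' ≡ p) → local p' (st s (e p')) ≡ local p' (st s' (e p'))
    unmoved p' (yes refl) = same
    unmoved p' (no p'≢p) = cong (local p') (sym (others (e p') (λ eq → p'≢p (e-inj eq))))

  reach-project : ∀ {s} → Reach S s → Reach T (project s)
  reach-project (init (initial-st , initial-ch)) =
    init ((λ p → trans (cong (local p) (initial-st (e p))) (local-q₀ p)) , (λ p q → initial-ch (e p) (e q)))
  reach-project (step r s) with project-move (move s)
  ... | inj₁ m = step (reach-project r) (as-stepT m)
  ... | inj₂ same = reach-≈ (reach-project r) same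

  deadlock-project : ∀ {s} → Deadlock S s → (∀ p → Receiving (T p) (local p (st s (e p)))) →
                     Deadlock T (project s)
  deadlock-project (empty , _) receiving = (λ p q → empty (e p) (e q)) , receiving

module GatewayShape {P R A : Set} (_≟P_ : DecidableEquality P)
       (e : P → R) (e-inj : ∀ {x y} → e x ≡ e y → x ≡ y)
       (M : CFSM P A) (H : P) (K : R) (fresh : ∀ p → e p ≢ K) where

  open Gateway _≟P_ e e-inj M H K fresh public

  data Edge : GQ → Act R A → GQ → Set where
    fetch   : ∀ {i q r a q'} .{ne : H ≢ r} → lookup (δ M) i ≡ (q , act H r ne snd a , q') →
              Edge (inj₁ q) (act K (e H) (λ eq → fresh H (sym eq)) rcv a) (inj₂ i)
    emit    : ∀ {i q r a q'} .{ne : H ≢ r} → lookup (δ M) i ≡ (q , act H r ne snd a , q') →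
              Edge (inj₂ i) (liftAct e e-inj (act H r ne snd a)) (inj₁ q')
    collect : ∀ {i q s a q'} .{ne : s ≢ H} → lookup (δ M) i ≡ (q , act s H ne rcv a , q') →
              Edge (inj₁ q) (liftAct e e-inj (act s H ne rcv a)) (inj₂ i)
    forward : ∀ {i q s a q'} .{ne : s ≢ H} → lookup (δ M) i ≡ (q , act s H ne rcv a , q') →
              Edge (inj₂ i) (act (e H) K (fresh H) snd a) (inj₁ q')

  edge-of : ∀ i {g l g'} → (g , l , g') ∈ gwT i → Edge g l g'
  edge-of i t with lookup (δ M) i in eq
  edge-of i t | (q , act s r ne snd a , q') with s ≟P H
  edge-of i (here refl) | (q , act s r ne snd a , q') | yes refl = fetch eq
  edge-of i (there (here refl)) | (q , act s r ne snd a , q') | yes refl = emit eq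
  edge-of i (there (there ())) | (q , act s r ne snd a , q') | yes refl
  edge-of i () | (q , act s r ne snd a , q') | no _
  edge-of i t | (q , act s r ne rcv a , q') with r ≟P H
  edge-of i (here refl) | (q , act s r ne rcv a , q') | yes refl = collect eq
  edge-of i (there (here refl)) | (q , act s r ne rcv a , q') | yes refl = forward eq
  edge-of i (there (there ())) | (q , act s r ne rcv a , q') | yes refl
  edge-of i () | (q , act s r ne rcv a , q') | no _

  edge : ∀ {g l g'} → (g , l , g') ∈ δ gw → Edge g l g'
  edge t with satisfied (∈-concatMap⁻ gwT {xs = allFin (length (δ M))} t)
  ... | i , t' = edge-of i t'

  lookup-∈ : ∀ {i t} → lookup (δ M) i ≡ t → t ∈ δ M
  lookup-∈ {i} refl = ∈-lookup i

  gwT-∈ : ∀ {i t} → t ∈ gwT i → t ∈ δ gw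
  gwT-∈ {i} t = ∈-concatMap⁺ gwT {xs = allFin (length (δ M))} (lose (∈-allFin i) t)

  emit-∈ : ∀ {i q r a q'} .{ne : H ≢ r} → lookup (δ M) i ≡ (q , act H r ne snd a , q') →
           (inj₂ i , liftAct e e-inj (act H r ne snd a) , inj₁ q') ∈ gwT i
  emit-∈ {i} eq with lookup (δ M) i | eq
  ... | _ | refl with H ≟P H
  ...   | yes refl = there (here refl)
  ...   | no H≢H = ⊥-elim (H≢H refl)

  forward-∈ : ∀ {i q s a q'} .{ne : s ≢ H} → lookup (δ M) i ≡ (q , act s H ne rcv a , q') →
              (inj₂ i , act (e H) K (fresh H) snd a , inj₁ q') ∈ gwT i
  forward-∈ {i} eq with lookup (δ M) i | eq
  ... | _ | refl with H ≟P H
  ...   | yes refl = there (here refl)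
  ...   | no H≢H = ⊥-elim (H≢H refl)

  data Phase : GQ → Set where
    idle       : ∀ q → Phase (inj₁ q)
    emitting   : ∀ {i q r a q'} .{ne : H ≢ r} → lookup (δ M) i ≡ (q , act H r ne snd a , q') →
                 Phase (inj₂ i)
    forwarding : ∀ {i q s a q'} .{ne : s ≢ H} → lookup (δ M) i ≡ (q , act s H ne rcv a , q') →
                 Phase (inj₂ i)

  target : ∀ {g} → Phase g → Q M
  target (idle q) = q
  target (emitting {q' = q'} _) = q'
  target (forwarding {q' = q'} _) = q'

  pending : ∀ {g} → Phase g → List A
  pending (idle _) = []
  pending (emitting _) = []
  pending (forwarding {a = a} _) = [ a ]

  -- a relaying gateway still has a send to perform, so it is not receiving
  relaying : ∀ {i} → Phase (inj₂ i) → ¬ Receiving gw (inj₂ i)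
  relaying (emitting eq) receiving = snd≢rcv (receiving (gwT-∈ (emit-∈ eq)))
  relaying (forwarding eq) receiving = snd≢rcv (receiving (gwT-∈ (forward-∈ eq)))

  -- The state of M as seen from H's own side: a relayed send becomes
  -- visible when it is emitted, a relayed receive as soon as it is collected.
  visible : Q M × Act P A × Q M → Q M
  visible (q , act _ _ _ snd _ , _) = q
  visible (_ , act _ _ _ rcv _ , q') = q'

  localView : GQ → Q M
  localView (inj₁ q) = q
  localView (inj₂ i) = visible (lookup (δ M) i)

  simulates : ∀ {g l g'} → (g , l , g') ∈ δ gw → Simulated e e-inj M (localView g) l (localView g')
  simulates t with edge t
  ... | fetch eq   = hidden (cong visible (sym eq)) (inj₁ fresh)
  ... | emit {r = r} {a} {q'} {ne} eq =
    lifted (subst (λ z → (visible z , act H r ne snd a , q') ∈ δ M) (sym eq) (lookup-∈ eq))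
  ... | collect {q = q} {s} {a} {ne = ne} eq =
    lifted (subst (λ z → (q , act s H ne rcv a , visible z) ∈ δ M) (sym eq) (lookup-∈ eq))
  ... | forward eq = hidden (cong visible eq) (inj₂ fresh)

record Endpoint (R A : Set) : Set₁ where
  constructor endpoint
  field
    Roles     : Set
    _≟_       : DecidableEquality Roles
    embed     : Roles → R
    embed-inj : ∀ {x y} → embed x ≡ embed y → x ≡ y
    machine   : CFSM Roles A
    gateway   : Roles

Apart : ∀ {R A : Set} → Endpoint R A → Endpoint R A → Set
Apart E E' = ∀ p → Endpoint.embed E p ≢ Endpoint.embed E' (Endpoint.gateway E')

module Relay {R A : Set} (E₁ E₂ : Endpoint R A) (fresh₁ : Apart E₁ E₂) (fresh₂ : Apart E₂ E₁) where
  open Endpoint E₁ using () renaming (machine to M₁; gateway to H; embed to e₁)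
  open Endpoint E₂ using () renaming (machine to M₂; gateway to K; embed to e₂)
  module G₁ = GatewayShape (Endpoint._≟_ E₁) e₁ (Endpoint.embed-inj E₁) M₁ H (e₂ K) fresh₁
  module G₂ = GatewayShape (Endpoint._≟_ E₂) e₂ (Endpoint.embed-inj E₂) M₂ K (e₁ H) fresh₂
  module R₁ = Runs M₁
  module R₂ = Runs M₂

  received : A → Dir × A
  received a = rcv , a

  -- c₁₂ and c₂₁ are the contents of the channels H→K and K→H
  record Inv (g₁ : G₁.GQ) (g₂ : G₂.GQ) (c₁₂ c₂₁ : List A) : Set where
    constructor relay
    field
      agreed   : List (Dir × A)
      x₁ x₂    : List A
      phase₁   : G₁.Phase g₁
      phase₂   : G₂.Phase g₂
      run₁     : R₁.ERun (q₀ M₁) (agreed ++ map received x₁) (G₁.target phase₁)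
      run₂     : R₂.ERun (q₀ M₂) (map dual agreed ++ map received x₂) (G₂.target phase₂)
      x₁-in-transit : x₁ ≡ c₁₂ ++ G₁.pending phase₁
      x₂-in-transit : x₂ ≡ c₂₁ ++ G₂.pending phase₂
      one-side : x₁ ≡ [] ⊎ x₂ ≡ []

  start : Inv (inj₁ (q₀ M₁)) (inj₁ (q₀ M₂)) [] []
  start = relay [] [] [] (G₁.idle _) (G₂.idle _) R₁.empty R₂.empty refl refl (inj₁ refl)

  recast : ∀ {g₁ g₁' g₂ g₂' c₁₂ c₁₂' c₂₁ c₂₁'} → g₁ ≡ g₁' → g₂ ≡ g₂' → c₁₂ ≡ c₁₂' → c₂₁ ≡ c₂₁' →
           Inv g₁ g₂ c₁₂ c₂₁ → Inv g₁' g₂' c₁₂' c₂₁'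
  recast refl refl refl refl i = i

module RelaySwap {R A : Set} (E₁ E₂ : Endpoint R A) (fresh₁ : Apart E₁ E₂) (fresh₂ : Apart E₂ E₁) where
  private
    module Here = Relay E₁ E₂ fresh₁ fresh₂
    module There = Relay E₂ E₁ fresh₂ fresh₁

  swap : ∀ {g₁ g₂ c₁₂ c₂₁} → Here.Inv g₁ g₂ c₁₂ c₂₁ → There.Inv g₂ g₁ c₂₁ c₁₂
  swap (Here.relay w x₁ x₂ φ₁ φ₂ r₁ r₂ t₁ t₂ one) =
    There.relay (map dual w) x₂ x₁ φ₂ φ₁ r₂
      (Here.R₁.cast (cong (_++ map Here.received x₁) (sym (dual-dual w))) r₁) t₂ t₁ (swap-⊎ one)

module RelayStep {R A : Set} (E₁ E₂ : Endpoint R A) (fresh₁ : Apart E₁ E₂) (fresh₂ : Apart E₂ E₁)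
                 (mirror : Mirrors (Endpoint.machine E₁) (Endpoint.machine E₂))
                 (det₂ : ?!Det (Endpoint.machine E₂)) (noMixed₂ : NoMixed (Endpoint.machine E₂)) where
  open Relay E₁ E₂ fresh₁ fresh₂
  open Endpoint E₁ using () renaming (machine to M₁; gateway to H; embed to e₁)
  open Endpoint E₂ using () renaming (machine to M₂; gateway to K; embed to e₂)
  open Answer mirror det₂ noMixed₂

  -- if H receives while M₂ is ahead, the two would cross: so M₂ is not ahead
  partner-idle : ∀ {w x₁ x₂ q l q' q₂} → x₁ ≡ [] ⊎ x₂ ≡ [] →
                 R₁.ERun (q₀ M₁) (w ++ map received x₁) q → (q , l , q') ∈ δ M₁ → dir l ≡ rcv →
                 R₂.ERun (q₀ M₂) (map dual w ++ map received x₂) q₂ → x₂ ≡ []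
  partner-idle (inj₂ x₂≡[]) _ _ _ _ = x₂≡[]
  partner-idle {x₂ = []} (inj₁ _) _ _ _ _ = refl
  partner-idle {w} {x₂ = _ ∷ _} (inj₁ refl) r₁ t d r₂ =
    ⊥-elim (no-crossing (R₁.cast (++-identityʳ w) r₁) t d r₂)

  -- H takes a from K: the send of a by M₁ joins the agreed trace, matching
  -- the receive of a that M₂ has already made
  after-fetch : ∀ {i q r a q' g₂ c₁₂ c₂₁} .{ne : H ≢ r} → lookup (δ M₁) i ≡ (q , act H r ne snd a , q') →
                Inv (inj₁ q) g₂ c₁₂ (a ∷ c₂₁) → Inv (inj₂ i) g₂ c₁₂ c₂₁
  after-fetch eq (relay _ _ _ (G₁.idle _) _ _ _ _ () (inj₂ refl))
  after-fetch {a = a} {c₂₁ = c₂₁} eq (relay w _ _ (G₁.idle _) φ₂ r₁ r₂ t₁ refl (inj₁ refl)) =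
    relay (w ++ [ (snd , a) ]) [] (c₂₁ ++ G₂.pending φ₂) (G₁.emitting eq) φ₂
      (R₁.cast agreed₁ (R₁.snoc r₁ (G₁.lookup-∈ eq))) (R₂.cast agreed₂ r₂) t₁ refl (inj₁ refl)
    where
    agreed₁ : (w ++ []) ++ [ (snd , a) ] ≡ (w ++ [ (snd , a) ]) ++ []
    agreed₁ = trans (cong (_++ [ (snd , a) ]) (++-identityʳ w)) (sym (++-identityʳ _))
    rest : List (Dir × A)
    rest = map received (c₂₁ ++ G₂.pending φ₂)
    agreed₂ : map dual w ++ (rcv , a) ∷ rest ≡ map dual (w ++ [ (snd , a) ]) ++ rest
    agreed₂ = sym (trans (cong (_++ rest) (map-++ dual w _)) (++-assoc (map dual w) [ (rcv , a) ] rest))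

  after-emit : ∀ {i q r a q' g₂ c₁₂ c₂₁} .{ne : H ≢ r} → lookup (δ M₁) i ≡ (q , act H r ne snd a , q') →
               Inv (inj₂ i) g₂ c₁₂ c₂₁ → Inv (inj₁ q') g₂ c₁₂ c₂₁
  after-emit eq (relay w x₁ x₂ (G₁.emitting eq₁) φ₂ r₁ r₂ t₁ t₂ one) with trans (sym eq₁) eq
  ... | refl = relay w x₁ x₂ (G₁.idle _) φ₂ r₁ r₂ t₁ t₂ one
  after-emit eq (relay _ _ _ (G₁.forwarding eq₁) _ _ _ _ _ _) with trans (sym eq₁) eq
  ... | ()

  after-collect : ∀ {i q s a q' g₂ c₁₂ c₂₁} .{ne : s ≢ H} → lookup (δ M₁) i ≡ (q , act s H ne rcv a , q') →
                  Inv (inj₁ q) g₂ c₁₂ c₂₁ → Inv (inj₂ i) g₂ c₁₂ c₂₁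
  after-collect {a = a} {c₁₂ = c₁₂} eq (relay w x₁ x₂ (G₁.idle _) φ₂ r₁ r₂ t₁ t₂ one)
    with partner-idle one r₁ (G₁.lookup-∈ eq) refl r₂
  ... | refl = relay w (x₁ ++ [ a ]) [] (G₁.forwarding eq) φ₂ (R₁.cast agreed₁ (R₁.snoc r₁ (G₁.lookup-∈ eq))) r₂
                 (cong (_++ [ a ]) (trans t₁ (++-identityʳ c₁₂))) t₂ (inj₂ refl)
    where
    agreed₁ : (w ++ map received x₁) ++ [ (rcv , a) ] ≡ w ++ map received (x₁ ++ [ a ])
    agreed₁ = trans (++-assoc w (map received x₁) _) (cong (w ++_) (sym (map-++ received x₁ [ a ])))

  after-forward : ∀ {i q s a q' g₂ c₁₂ c₂₁} .{ne : s ≢ H} → lookup (δ M₁) i ≡ (q , act s H ne rcv a , q') →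
                  Inv (inj₂ i) g₂ c₁₂ c₂₁ → Inv (inj₁ q') g₂ (c₁₂ ++ [ a ]) c₂₁
  after-forward eq (relay w x₁ x₂ (G₁.forwarding eq₁) φ₂ r₁ r₂ t₁ t₂ one) with trans (sym eq₁) eq
  ... | refl = relay w x₁ x₂ (G₁.idle _) φ₂ r₁ r₂ (trans t₁ (sym (++-identityʳ _))) t₂ one
  after-forward eq (relay _ _ _ (G₁.emitting eq₁) _ _ _ _ _ _) with trans (sym eq₁) eq
  ... | ()

  step₁ : ∀ {g l g' g₂ c₁₂ c₂₁ c₁₂' c₂₁'} → G₁.Edge g l g' →
          ChannelEffect (e₁ H) (e₂ K) l c₁₂ c₁₂' → ChannelEffect (e₂ K) (e₁ H) l c₂₁ c₂₁' →
          Inv g g₂ c₁₂ c₂₁ → Inv g' g₂ c₁₂' c₂₁'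
  step₁ (G₁.fetch eq) hk kh i =
    after-fetch eq (recast refl refl (sym (untouched hk (λ { (x , _) → fresh₁ H x }))) (popped kh refl refl refl) i)
  step₁ (G₁.emit eq) hk kh i =
    recast refl refl (sym (untouched hk (λ { (_ , y) → fresh₁ _ (sym y) })))
                     (sym (untouched kh (λ { (x , _) → fresh₁ H (sym x) }))) (after-emit eq i)
  step₁ (G₁.collect eq) hk kh i =
    recast refl refl (sym (untouched hk (λ { (_ , y) → fresh₁ H (sym y) })))
                     (sym (untouched kh (λ { (x , _) → fresh₁ _ (sym x) }))) (after-collect eq i)
  step₁ (G₁.forward eq) hk kh i =
    recast refl refl (sym (appended hk refl refl refl))
                     (sym (untouched kh (λ { (x , _) → fresh₁ H (sym x) }))) (after-forward eq i)

  settle : ∀ {g₁ g₂} → Inv g₁ g₂ [] [] → Receiving G₁.gw g₁ → Receiving G₂.gw g₂ →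
           ∃ λ q₁ → ∃ λ q₂ → g₁ ≡ inj₁ q₁ × g₂ ≡ inj₁ q₂ × (Receiving M₁ q₁ ⊎ Receiving M₂ q₂)
  settle {inj₂ _} (relay _ _ _ φ₁ _ _ _ _ _ _) receiving₁ _ = ⊥-elim (G₁.relaying φ₁ receiving₁)
  settle {inj₁ _} {inj₂ _} (relay _ _ _ _ φ₂ _ _ _ _ _) _ receiving₂ = ⊥-elim (G₂.relaying φ₂ receiving₂)
  settle {inj₁ q₁} {inj₁ q₂} (relay w _ _ (G₁.idle _) (G₂.idle _) r₁ r₂ refl refl _) _ _ =
    q₁ , q₂ , refl , refl , one-receives (R₁.cast (++-identityʳ w) r₁) (R₂.cast (++-identityʳ _) r₂)

module Composition {n₁ n₂ m : ℕ} (S₁ : System (Fin n₁) (Fin m)) (S₂ : System (Fin n₂) (Fin m))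
                   (H : Fin n₁) (K : Fin n₂) (compatible : Compatible (S₁ H) (S₂ K)) where

  S : System (Fin n₁ ⊎ Fin n₂) (Fin m)
  S = S₁ ⋈[ H , K ] S₂

  ι₁ : Fin n₁ → Fin n₁ ⊎ Fin n₂
  ι₁ = inj₁

  ι₂ : Fin n₂ → Fin n₁ ⊎ Fin n₂
  ι₂ = inj₂

  E₁ E₂ : Endpoint (Fin n₁ ⊎ Fin n₂) (Fin m)
  E₁ = endpoint (Fin n₁) _≟F_ ι₁ inj₁-inj (S₁ H) H
  E₂ = endpoint (Fin n₂) _≟F_ ι₂ inj₂-inj (S₂ K) K

  fresh₁ : Apart E₁ E₂
  fresh₁ _ ()

  fresh₂ : Apart E₂ E₁
  fresh₂ _ ()

  open Relay E₁ E₂ fresh₁ fresh₂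
  open Moves S using (Move; mkMove; move)

  noMixed₁ : NoMixed (S₁ H)
  noMixed₁ = proj₁ (proj₂ compatible)

  noMixed₂ : NoMixed (S₂ K)
  noMixed₂ = proj₁ (proj₂ (proj₂ compatible))

  det₁ : ?!Det (S₁ H)
  det₁ = proj₁ (proj₂ (proj₂ (proj₂ compatible)))

  det₂ : ?!Det (S₂ K)
  det₂ = proj₂ (proj₂ (proj₂ (proj₂ compatible)))

  module Step₁ = RelayStep E₁ E₂ fresh₁ fresh₂ (proj₁ (compatible-mirrors compatible)) det₂ noMixed₂
  module Step₂ = RelayStep E₂ E₁ fresh₂ fresh₁ (proj₂ (compatible-mirrors compatible)) det₁ noMixed₁
  module Swap₁₂ = RelaySwap E₁ E₂ fresh₁ fresh₂
  module Swap₂₁ = RelaySwap E₂ E₁ fresh₂ fresh₁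

  step₂ : ∀ {g l g' g₁ c₁₂ c₂₁ c₁₂' c₂₁'} → G₂.Edge g l g' →
          ChannelEffect (inj₂ K) (inj₁ H) l c₂₁ c₂₁' → ChannelEffect (inj₁ H) (inj₂ K) l c₁₂ c₁₂' →
          Inv g₁ g c₁₂ c₂₁ → Inv g₁ g' c₁₂' c₂₁'
  step₂ edge kh hk i = Swap₂₁.swap (Step₂.step₁ edge kh hk (Swap₁₂.swap i))

  gate₁ : Q (S (inj₁ H)) → G₁.GQ
  gate₁ g with H ≟F H
  ... | yes refl = g
  ... | no H≢H = ⊥-elim (H≢H refl)

  gate₁-δ : ∀ {g l g'} → (g , l , g') ∈ δ (S (inj₁ H)) → (gate₁ g , l , gate₁ g') ∈ δ G₁.gw
  gate₁-δ t with H ≟F H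
  ... | yes refl = t
  ... | no H≢H = ⊥-elim (H≢H refl)

  gate₁-q₀ : gate₁ (q₀ (S (inj₁ H))) ≡ inj₁ (q₀ (S₁ H))
  gate₁-q₀ with H ≟F H
  ... | yes refl = refl
  ... | no H≢H = ⊥-elim (H≢H refl)

  gate₁-receiving : ∀ {g} → Receiving (S (inj₁ H)) g → Receiving G₁.gw (gate₁ g)
  gate₁-receiving receiving with H ≟F H
  ... | yes refl = receiving
  ... | no H≢H = ⊥-elim (H≢H refl)

  gate₂ : Q (S (inj₂ K)) → G₂.GQ
  gate₂ g with K ≟F K
  ... | yes refl = g
  ... | no K≢K = ⊥-elim (K≢K refl)

  gate₂-δ : ∀ {g l g'} → (g , l , g') ∈ δ (S (inj₂ K)) → (gate₂ g , l , gate₂ g') ∈ δ G₂.gw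
  gate₂-δ t with K ≟F K
  ... | yes refl = t
  ... | no K≢K = ⊥-elim (K≢K refl)

  gate₂-q₀ : gate₂ (q₀ (S (inj₂ K))) ≡ inj₁ (q₀ (S₂ K))
  gate₂-q₀ with K ≟F K
  ... | yes refl = refl
  ... | no K≢K = ⊥-elim (K≢K refl)

  gate₂-receiving : ∀ {g} → Receiving (S (inj₂ K)) g → Receiving G₂.gw (gate₂ g)
  gate₂-receiving receiving with K ≟F K
  ... | yes refl = receiving
  ... | no K≢K = ⊥-elim (K≢K refl)

  InvAt : Config S → Set
  InvAt s = Inv (gate₁ (st s (inj₁ H))) (gate₂ (st s (inj₂ K))) (ch s (inj₁ H) (inj₂ K)) (ch s (inj₂ K) (inj₁ H))

  data Position : Fin n₁ ⊎ Fin n₂ → Set where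
    at-H      : Position (inj₁ H)
    at-K      : Position (inj₂ K)
    bystander : ∀ {r} → r ≢ inj₁ H → r ≢ inj₂ K → Position r

  position : ∀ r → Position r
  position (inj₁ p) with p ≟F H
  ... | yes refl = at-H
  ... | no p≢H = bystander (λ eq → p≢H (inj₁-inj eq)) (λ ())
  position (inj₂ p) with p ≟F K
  ... | yes refl = at-K
  ... | no p≢K = bystander (λ ()) (λ eq → p≢K (inj₂-inj eq))

  preserve : ∀ {s s'} (mv : Move s s') → Position (Move.actor mv) → InvAt s → InvAt s'
  preserve (mkMove _ _ _ t others eff) at-H =
    recast refl (cong gate₂ (sym (others (inj₂ K) (λ ())))) refl refl
    ∘ Step₁.step₁ (G₁.edge (gate₁-δ t)) (eff _ _) (eff _ _)
  preserve (mkMove _ _ _ t others eff) at-K =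
    recast (cong gate₁ (sym (others (inj₁ H) (λ ())))) refl refl refl
    ∘ step₂ (G₂.edge (gate₂-δ t)) (eff _ _) (eff _ _)
  preserve (mkMove _ _ perf _ others eff) (bystander r≢H r≢K) =
    recast (cong gate₁ (sym (others (inj₁ H) (λ eq → r≢H (sym eq)))))
           (cong gate₂ (sym (others (inj₂ K) (λ eq → r≢K (sym eq)))))
           (sym (untouched-by perf r≢H r≢K (eff _ _)))
           (sym (untouched-by perf r≢K r≢H (eff _ _)))

  invariant : ∀ {s} → Reach S s → InvAt s
  invariant (init (initial-st , initial-ch)) =
    recast (sym (trans (cong gate₁ (initial-st _)) gate₁-q₀)) (sym (trans (cong gate₂ (initial-st _)) gate₂-q₀))
           (sym (initial-ch _ _)) (sym (initial-ch _ _)) start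
  invariant (step r s) = preserve (move s) (position _) (invariant r)

  local₁ : ∀ p → Q (S (inj₁ p)) → Q (S₁ p)
  local₁ p g with p ≟F H
  ... | yes refl = G₁.localView g
  ... | no _ = g

  local₁-q₀ : ∀ p → local₁ p (q₀ (S (inj₁ p))) ≡ q₀ (S₁ p)
  local₁-q₀ p with p ≟F H
  ... | yes refl = refl
  ... | no _ = refl

  simulate₁ : ∀ p {g l g'} → (g , l , g') ∈ δ (S (inj₁ p)) →
              Simulated ι₁ inj₁-inj (S₁ p) (local₁ p g) l (local₁ p g')
  simulate₁ p t with p ≟F H
  ... | yes refl = G₁.simulates t
  ... | no _ = Lifting.lifted-simulates ι₁ inj₁-inj t

  image₁? : ∀ r → (∃ λ p → ι₁ p ≡ r) ⊎ (∀ p → ι₁ p ≢ r)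
  image₁? (inj₁ p) = inj₁ (p , refl)
  image₁? (inj₂ _) = inj₂ (λ _ ())

  module Project₁ = Projection _≟F_ S S₁ ι₁ inj₁-inj image₁? local₁ local₁-q₀ simulate₁

  settled₁ : ∀ {q} (g : Q (S (inj₁ H))) → gate₁ g ≡ inj₁ q →
             g ≡ embSt₁ S₁ S₂ H K H (local₁ H g) × local₁ H g ≡ q
  settled₁ g eq with H ≟F H
  settled₁ g refl | yes refl = refl , refl
  settled₁ g eq | no H≢H = ⊥-elim (H≢H refl)

  plain₁ : ∀ p → p ≢ H → (g : Q (S (inj₁ p))) →
           g ≡ embSt₁ S₁ S₂ H K p (local₁ p g) × (Receiving (S (inj₁ p)) g → Receiving (S₁ p) (local₁ p g))
  plain₁ p p≢H g with p ≟F H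
  ... | yes p≡H = ⊥-elim (p≢H p≡H)
  ... | no _ = refl , Lifting.lifted-receiving ι₁ inj₁-inj {M = S₁ p}

  restrict₁ : ∀ {s q} → Reach S s → Deadlock S s → gate₁ (st s (inj₁ H)) ≡ inj₁ q → Receiving (S₁ H) q →
              ∃ λ c₁ → Restr₁ S₁ S₂ H K s c₁ × Reach S₁ c₁ × Deadlock S₁ c₁
  restrict₁ {s} reach dead settled receiving =
    Project₁.project s , ((λ p → state p (p ≟F H)) , λ _ _ → refl) ,
    Project₁.reach-project reach , Project₁.deadlock-project dead (λ p → local-receiving p (p ≟F H))
    where
    state : ∀ p → Dec (p ≡ H) → st s (inj₁ p) ≡ embSt₁ S₁ S₂ H K p (local₁ p (st s (inj₁ p)))
    state p (yes refl) = proj₁ (settled₁ _ settled)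
    state p (no p≢H) = proj₁ (plain₁ p p≢H _)
    local-receiving : ∀ p → Dec (p ≡ H) → Receiving (S₁ p) (local₁ p (st s (inj₁ p)))
    local-receiving p (yes refl) = subst (Receiving (S₁ H)) (sym (proj₂ (settled₁ _ settled))) receiving
    local-receiving p (no p≢H) = proj₂ (plain₁ p p≢H _) (proj₂ dead (inj₁ p))

  local₂ : ∀ p → Q (S (inj₂ p)) → Q (S₂ p)
  local₂ p g with p ≟F K
  ... | yes refl = G₂.localView g
  ... | no _ = g

  local₂-q₀ : ∀ p → local₂ p (q₀ (S (inj₂ p))) ≡ q₀ (S₂ p)
  local₂-q₀ p with p ≟F K
  ... | yes refl = refl
  ... | no _ = refl

  simulate₂ : ∀ p {g l g'} → (g , l , g') ∈ δ (S (inj₂ p)) →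
              Simulated ι₂ inj₂-inj (S₂ p) (local₂ p g) l (local₂ p g')
  simulate₂ p t with p ≟F K
  ... | yes refl = G₂.simulates t
  ... | no _ = Lifting.lifted-simulates ι₂ inj₂-inj t

  image₂? : ∀ r → (∃ λ p → ι₂ p ≡ r) ⊎ (∀ p → ι₂ p ≢ r)
  image₂? (inj₁ _) = inj₂ (λ _ ())
  image₂? (inj₂ p) = inj₁ (p , refl)

  module Project₂ = Projection _≟F_ S S₂ ι₂ inj₂-inj image₂? local₂ local₂-q₀ simulate₂

  settled₂ : ∀ {q} (g : Q (S (inj₂ K))) → gate₂ g ≡ inj₁ q →
             g ≡ embSt₂ S₁ S₂ H K K (local₂ K g) × local₂ K g ≡ q
  settled₂ g eq with K ≟F K
  settled₂ g refl | yes refl = refl , refl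
  settled₂ g eq | no K≢K = ⊥-elim (K≢K refl)

  plain₂ : ∀ p → p ≢ K → (g : Q (S (inj₂ p))) →
           g ≡ embSt₂ S₁ S₂ H K p (local₂ p g) × (Receiving (S (inj₂ p)) g → Receiving (S₂ p) (local₂ p g))
  plain₂ p p≢K g with p ≟F K
  ... | yes p≡K = ⊥-elim (p≢K p≡K)
  ... | no _ = refl , Lifting.lifted-receiving ι₂ inj₂-inj {M = S₂ p}

  restrict₂ : ∀ {s q} → Reach S s → Deadlock S s → gate₂ (st s (inj₂ K)) ≡ inj₁ q → Receiving (S₂ K) q →
              ∃ λ c₂ → Restr₂ S₁ S₂ H K s c₂ × Reach S₂ c₂ × Deadlock S₂ c₂
  restrict₂ {s} reach dead settled receiving =
    Project₂.project s , ((λ p → state p (p ≟F K)) , λ _ _ → refl) ,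
    Project₂.reach-project reach , Project₂.deadlock-project dead (λ p → local-receiving p (p ≟F K))
    where
    state : ∀ p → Dec (p ≡ K) → st s (inj₂ p) ≡ embSt₂ S₁ S₂ H K p (local₂ p (st s (inj₂ p)))
    state p (yes refl) = proj₁ (settled₂ _ settled)
    state p (no p≢K) = proj₁ (plain₂ p p≢K _)
    local-receiving : ∀ p → Dec (p ≡ K) → Receiving (S₂ p) (local₂ p (st s (inj₂ p)))
    local-receiving p (yes refl) = subst (Receiving (S₂ K)) (sym (proj₂ (settled₂ _ settled))) receiving
    local-receiving p (no p≢K) = proj₂ (plain₂ p p≢K _) (proj₂ dead (inj₂ p))

  theorem : ∀ s → Reach S s → Deadlock S s →
            (∃ λ c₁ → Restr₁ S₁ S₂ H K s c₁ × Reach S₁ c₁ × Deadlock S₁ c₁)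
            ⊎ (∃ λ c₂ → Restr₂ S₁ S₂ H K s c₂ × Reach S₂ c₂ × Deadlock S₂ c₂)
  theorem s reach dead@(empty , receiving)
    with Step₁.settle (recast refl refl (empty _ _) (empty _ _) (invariant reach))
                      (gate₁-receiving (receiving (inj₁ H))) (gate₂-receiving (receiving (inj₂ K)))
  ... | _ , _ , settled₁ , _ , inj₁ receiving₁ = inj₁ (restrict₁ reach dead settled₁ receiving₁)
  ... | _ , _ , _ , settled₂ , inj₂ receiving₂ = inj₂ (restrict₂ reach dead settled₂ receiving₂)

lemma3 : ∀ {n₁ n₂ m} (S₁ : System (Fin n₁) (Fin m)) (S₂ : System (Fin n₂) (Fin m))
           (H : Fin n₁) (K : Fin n₂) →
           Compatible (S₁ H) (S₂ K) →
           (s : Config (S₁ ⋈[ H , K ] S₂)) →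
           Reach (S₁ ⋈[ H , K ] S₂) s →
           Deadlock (S₁ ⋈[ H , K ] S₂) s →
           (∃ λ c₁ → Restr₁ S₁ S₂ H K s c₁ × Reach S₁ c₁ × Deadlock S₁ c₁)
           ⊎ (∃ λ c₂ → Restr₂ S₁ S₂ H K s c₂ × Reach S₂ c₂ × Deadlock S₂ c₂)
lemma3 S₁ S₂ H K compatible = Composition.theorem S₁ S₂ H K compatible
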